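{- Let $n\ge 5$ and $L=\{0,2,3\}$. Then $f(n,3,4,L)=n+1$.
   Context: $f(n,3,4,L)$ denotes the number of $3$-uniform hypergraphs on the vertex set $[n]=\{1,\ldots,n\}$ such that no set of $4$ vertices spans exactly $i$ edges for any $i\in L$. -}

module Defs where

open import Data.Bool using (Bool; true; false; _∧_; _∨_; not; if_then_else_)
open import Data.Nat using (ℕ; zero; suc; _+_; _<ᵇ_; _≡ᵇ_)
open import Data.Fin using (Fin; toℕ)
open import Data.List using (List; []; _∷_; map; concatMap)
open import Data.List.Base using (allFin)
open import Data.Vec using (Vec; []; _∷_; lookup)

allVec : {A : Set} → List A → (n : ℕ) → List (Vec A n)
allVec xs zero    = [] ∷ []
allVec xs (suc n) = concatMap (λ x → map (x ∷_) (allVec xs n)) xs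

-- A 3-uniform hypergraph on [n]
-- (vertices Fin n) is encoded as a cube with H[i][j][k] = true iff
-- {i,j,k} is an edge, for i < j < k; all other entries must be false.
Cube : ℕ → Set
Cube n = Vec (Vec (Vec Bool n) n) n

allCubes : (n : ℕ) → List (Cube n)
allCubes n = allVec (allVec (allVec (true ∷ false ∷ []) n) n) n

entry : {n : ℕ} → Cube n → Fin n → Fin n → Fin n → Bool
entry H i j k = lookup (lookup (lookup H i) j) k

_<F_ : {n : ℕ} → Fin n → Fin n → Bool
i <F j = toℕ i <ᵇ toℕ j

allᵇ : {A : Set} → (A → Bool) → List A → Bool
allᵇ p []       = true
allᵇ p (x ∷ xs) = p x ∧ allᵇ p xs

countᵇ : {A : Set} → (A → Bool) → List A → ℕ
countᵇ p []       = 0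
countᵇ p (x ∷ xs) = (if p x then 1 else 0) + countᵇ p xs

∀v : (n : ℕ) → (Fin n → Bool) → Bool
∀v n p = allᵇ p (allFin n)

WellFormed : {n : ℕ} → Cube n → Bool
WellFormed {n} H =
  ∀v n λ i → ∀v n λ j → ∀v n λ k →
    not (entry H i j k) ∨ ((i <F j) ∧ (j <F k))

b2n : Bool → ℕ
b2n true  = 1
b2n false = 0

edgesIn4 : {n : ℕ} → Cube n → Fin n → Fin n → Fin n → Fin n → ℕ
edgesIn4 H a b c d =
  b2n (entry H a b c) + b2n (entry H a b d) + b2n (entry H a c d) + b2n (entry H b c d)

_∈ᵇ_ : ℕ → List ℕ → Bool
m ∈ᵇ []       = false
m ∈ᵇ (x ∷ xs) = (m ≡ᵇ x) ∨ (m ∈ᵇ xs)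

Avoids : {n : ℕ} → List ℕ → Cube n → Bool
Avoids {n} L H =
  ∀v n λ a → ∀v n λ b → ∀v n λ c → ∀v n λ d →
    not ((a <F b) ∧ (b <F c) ∧ (c <F d)) ∨ not (edgesIn4 H a b c d ∈ᵇ L)

f34 : ℕ → List ℕ → ℕ
f34 n L = countᵇ (λ H → WellFormed H ∧ Avoids L H) (allCubes n)

{-# OPTIONS --safe #-}
module Submission where

-- Every 4-set of vertices spans one or four edges. If some triple abc is not an edge, then
-- {a,b,c,d} spans a single edge pqs for any further vertex d; call the remaining vertex v
-- the apex. Trading s for any other vertex u preserves this shape (a parity argument), so
-- every triple through v is a non-edge and every triple avoiding v is an edge. Hence the
-- admissible hypergraphs are the complete one and, for each vertex v, the one formed by the
-- triples avoiding v; these n + 1 hypergraphs are pairwise distinct.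

open import Defs
open import Data.Nat using (ℕ; _≤_; _+_)
open import Data.List using (List; []; _∷_)
open import Relation.Binary.PropositionalEquality using (_≡_)

open import Data.Bool using (Bool; true; false; _∧_; _∨_; not; if_then_else_)
open import Data.Bool.Properties
  using (∨-commutativeMonoid; ∨-comm; ∨-assoc; ∨-identityʳ; ∧-conicalˡ; ∧-conicalʳ; ¬-not; T-≡)
  renaming (_≟_ to _≟ᵇ_)
open import Algebra.Solver.CommutativeMonoid ∨-commutativeMonoid using (solve; _⊜_; _⊕_)
import Data.Nat as ℕ
open import Data.Nat.Properties using (+-assoc; +-suc; +-comm; ≤-trans; n≤1+n; <⇒≤; <ᵇ⇒<; <⇒<ᵇ; <⇒≱)
open import Data.Fin using (Fin; toℕ; _<_)
open import Data.Fin.Properties using (_≟_; _<?_; <-cmp; <-trans; <-asym; <⇒≢; any?; injective⇒≤)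
import Data.List as List
open import Data.List using (length; map; concatMap; _++_; tabulate; allFin)
open import Data.List.Properties using (length-tabulate)
open import Data.List.Membership.Propositional using (_∈_; _∉_)
open import Data.List.Membership.Propositional.Properties using (∈-allFin; ∈-tabulate⁺; ∈-tabulate⁻)
import Data.List.Membership.DecPropositional as DecMembership
open import Data.List.Relation.Unary.Any using (here; there)
open import Data.List.Relation.Unary.Any.Properties using (lookup-index)
import Data.List.Relation.Unary.All.Properties as All
open import Data.List.Relation.Unary.AllPairs using ([]; _∷_)
import Data.List.Relation.Unary.AllPairs.Properties as AllPairs
open import Data.List.Relation.Unary.Unique.Propositional using (Unique)
open import Data.Vec using (Vec; []; _∷_; lookup) renaming (tabulate to tabulateᵥ)
open import Data.Vec.Properties using (≡-dec; lookup∘tabulate; tabulate∘lookup; tabulate-cong)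
open import Data.Product using (∃; _×_; _,_; proj₁; proj₂)
open import Data.Empty using (⊥)
open import Data.Sum using (_⊎_; inj₁; inj₂)
open import Function using (_∘_)
open import Function.Bundles using (Equivalence)
open import Relation.Binary using (DecidableEquality; tri<; tri≈; tri>)
open import Relation.Binary.PropositionalEquality
  using (_≢_; refl; sym; trans; cong; cong₂; ≢-sym; module ≡-Reasoning)
open import Relation.Nullary using (¬_; Dec; yes; no; does; contradiction)
open import Relation.Nullary.Decidable using (dec-true; dec-false; decidable-stable; ¬?; _×-dec_)

open ≡-Reasoning

L₀₂₃ : List ℕ
L₀₂₃ = 0 ∷ 2 ∷ 3 ∷ []

data OneOrAll : Bool → Bool → Bool → Bool → Set where
  all₄  : OneOrAll true  true  true  true
  only₁ : OneOrAll true  false false false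
  only₂ : OneOrAll false true  false false
  only₃ : OneOrAll false false true  false
  only₄ : OneOrAll false false false true

∉L₀₂₃⇒oneOrAll : ∀ a b c d → not ((b2n a + b2n b + b2n c + b2n d) ∈ᵇ L₀₂₃) ≡ true → OneOrAll a b c d
∉L₀₂₃⇒oneOrAll true  true  true  true  _  = all₄
∉L₀₂₃⇒oneOrAll true  true  true  false ()
∉L₀₂₃⇒oneOrAll true  true  false true  ()
∉L₀₂₃⇒oneOrAll true  true  false false ()
∉L₀₂₃⇒oneOrAll true  false true  true  ()
∉L₀₂₃⇒oneOrAll true  false true  false ()
∉L₀₂₃⇒oneOrAll true  false false true  ()
∉L₀₂₃⇒oneOrAll true  false false false _  = only₁
∉L₀₂₃⇒oneOrAll false true  true  true  ()
∉L₀₂₃⇒oneOrAll false true  true  false ()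
∉L₀₂₃⇒oneOrAll false true  false true  ()
∉L₀₂₃⇒oneOrAll false true  false false _  = only₂
∉L₀₂₃⇒oneOrAll false false true  true  ()
∉L₀₂₃⇒oneOrAll false false true  false _  = only₃
∉L₀₂₃⇒oneOrAll false false false true  _  = only₄
∉L₀₂₃⇒oneOrAll false false false false ()

oneOrAll⇒∉L₀₂₃ : ∀ {a b c d} → OneOrAll a b c d → not ((b2n a + b2n b + b2n c + b2n d) ∈ᵇ L₀₂₃) ≡ true
oneOrAll⇒∉L₀₂₃ all₄  = refl
oneOrAll⇒∉L₀₂₃ only₁ = refl
oneOrAll⇒∉L₀₂₃ only₂ = refl
oneOrAll⇒∉L₀₂₃ only₃ = refl
oneOrAll⇒∉L₀₂₃ only₄ = refl

oneOrAll-cong : ∀ {a a′ b b′ c c′ d d′} → a ≡ a′ → b ≡ b′ → c ≡ c′ → d ≡ d′ →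
                OneOrAll a b c d → OneOrAll a′ b′ c′ d′
oneOrAll-cong refl refl refl refl h = h

oneOrAll-swap₁₂ : ∀ {a b c d} → OneOrAll a b c d → OneOrAll b a c d
oneOrAll-swap₁₂ all₄  = all₄
oneOrAll-swap₁₂ only₁ = only₂
oneOrAll-swap₁₂ only₂ = only₁
oneOrAll-swap₁₂ only₃ = only₃
oneOrAll-swap₁₂ only₄ = only₄

oneOrAll-swap₂₃ : ∀ {a b c d} → OneOrAll a b c d → OneOrAll a c b d
oneOrAll-swap₂₃ all₄  = all₄
oneOrAll-swap₂₃ only₁ = only₁
oneOrAll-swap₂₃ only₂ = only₃
oneOrAll-swap₂₃ only₃ = only₂
oneOrAll-swap₂₃ only₄ = only₄

oneOrAll-swap₃₄ : ∀ {a b c d} → OneOrAll a b c d → OneOrAll a b d c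
oneOrAll-swap₃₄ all₄  = all₄
oneOrAll-swap₃₄ only₁ = only₁
oneOrAll-swap₃₄ only₂ = only₂
oneOrAll-swap₃₄ only₃ = only₄
oneOrAll-swap₃₄ only₄ = only₃

oneOrAll-last : ∀ {d} → OneOrAll false false false d → d ≡ true
oneOrAll-last only₄ = refl

-- Read a, b, c as vpu, vqu, vsu and d, e, f as pqu, psu, qsu, where {v,p,q,s} spans
-- only pqs. If {p,q,s,u} spanned only pqs, each of {v,p,q,u}, {v,p,s,u}, {v,q,s,u}
-- would contain exactly one edge among vpu, vqu, vsu, each of which lies in two of
-- these sets: a parity clash.
oneOrAll-extend : ∀ {a b c d e f} →
  OneOrAll false a b d → OneOrAll false a c e → OneOrAll false b c f → OneOrAll true d e f →
  a ≡ false × b ≡ false × d ≡ true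
oneOrAll-extend only₄ only₄ only₄ all₄  = refl , refl , refl
oneOrAll-extend only₂ only₂ () only₁
oneOrAll-extend only₃ only₃ () only₁

not∨-elim : ∀ {a b} → (not a ∨ b) ≡ true → a ≡ true → b ≡ true
not∨-elim {true} b≡true refl = b≡true

not∨-intro : ∀ {a b} → (a ≡ true → b ≡ true) → (not a ∨ b) ≡ true
not∨-intro {true}  a⇒b = a⇒b refl
not∨-intro {false} _   = refl

allᵇ-∈ : ∀ {A : Set} {p : A → Bool} {xs x} → allᵇ p xs ≡ true → x ∈ xs → p x ≡ true
allᵇ-∈ {p = p} {y ∷ _} all (here refl) = ∧-conicalˡ (p y) _ all
allᵇ-∈ {p = p} {y ∷ _} all (there x∈) = allᵇ-∈ (∧-conicalʳ (p y) _ all) x∈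

allᵇ-intro : ∀ {A : Set} {p : A → Bool} → (∀ x → p x ≡ true) → ∀ xs → allᵇ p xs ≡ true
allᵇ-intro p-true []       = refl
allᵇ-intro p-true (x ∷ xs) rewrite p-true x = allᵇ-intro p-true xs

∀v-elim : ∀ {n} {p : Fin n → Bool} → ∀v n p ≡ true → ∀ i → p i ≡ true
∀v-elim all i = allᵇ-∈ all (∈-allFin i)

∀v-intro : ∀ {n} {p : Fin n → Bool} → (∀ i → p i ≡ true) → ∀v n p ≡ true
∀v-intro {n} p-true = allᵇ-intro p-true (allFin n)

countᵇ-cong : ∀ {A : Set} {p q : A → Bool} → (∀ x → p x ≡ q x) → ∀ xs → countᵇ p xs ≡ countᵇ q xs
countᵇ-cong p≗q []       = refl
countᵇ-cong p≗q (x ∷ xs) = cong₂ (λ b m → (if b then 1 else 0) + m) (p≗q x) (countᵇ-cong p≗q xs)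

countᵇ-++ : ∀ {A : Set} (p : A → Bool) xs ys → countᵇ p (xs ++ ys) ≡ countᵇ p xs + countᵇ p ys
countᵇ-++ p []       ys = refl
countᵇ-++ p (x ∷ xs) ys =
  trans (cong ((if p x then 1 else 0) +_) (countᵇ-++ p xs ys)) (sym (+-assoc (if p x then 1 else 0) _ _))

countᵇ-map : ∀ {A B : Set} (p : B → Bool) (f : A → B) xs → countᵇ p (map f xs) ≡ countᵇ (p ∘ f) xs
countᵇ-map p f []       = refl
countᵇ-map p f (x ∷ xs) = cong ((if p (f x) then 1 else 0) +_) (countᵇ-map p f xs)

countᵇ-false : ∀ {A : Set} {p : A → Bool} → (∀ x → p x ≡ false) → ∀ xs → countᵇ p xs ≡ 0
countᵇ-false p-false []       = refl
countᵇ-false p-false (x ∷ xs) rewrite p-false x = countᵇ-false p-false xs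

countᵇ-∨ : ∀ {A : Set} (p q : A → Bool) → (∀ x → p x ≡ true → q x ≡ false) →
  ∀ xs → countᵇ (λ x → p x ∨ q x) xs ≡ countᵇ p xs + countᵇ q xs
countᵇ-∨ p q disjoint []       = refl
countᵇ-∨ p q disjoint (x ∷ xs) with p x in px | q x in qx
... | true  | true  = contradiction (trans (sym qx) (disjoint x px)) λ ()
... | true  | false = cong ℕ.suc (countᵇ-∨ p q disjoint xs)
... | false | true  = trans (cong ℕ.suc (countᵇ-∨ p q disjoint xs)) (sym (+-suc _ _))
... | false | false = countᵇ-∨ p q disjoint xs

IsEnumeration : {A : Set} → DecidableEquality A → List A → Set
IsEnumeration _≟ₐ_ xs = ∀ a → countᵇ (λ x → does (x ≟ₐ a)) xs ≡ 1

module _ {A : Set} (_≟ₐ_ : DecidableEquality A) where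
  open DecMembership _≟ₐ_ using (_∈?_)

  allVec-enumeration : ∀ {xs} → IsEnumeration _≟ₐ_ xs → ∀ n → IsEnumeration (≡-dec _≟ₐ_) (allVec xs n)
  allVec-enumeration enum ℕ.zero    []      = refl
  allVec-enumeration {xs} enum (ℕ.suc n) (a ∷ v) = trans (byHead xs) (enum a)
    where
    p : Vec A (ℕ.suc n) → Bool
    p w = does (≡-dec _≟ₐ_ w (a ∷ v))

    extensions : A → List (Vec A (ℕ.suc n))
    extensions y = map (y ∷_) (allVec xs n)

    withHead : ∀ y → countᵇ p (extensions y) ≡ (if does (y ≟ₐ a) then 1 else 0)
    withHead y rewrite countᵇ-map p (y ∷_) (allVec xs n) with does (y ≟ₐ a)
    ... | true  = allVec-enumeration enum n v
    ... | false = countᵇ-false (λ _ → refl) (allVec xs n)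

    byHead : ∀ ys → countᵇ p (concatMap extensions ys) ≡ countᵇ (λ y → does (y ≟ₐ a)) ys
    byHead []       = refl
    byHead (y ∷ ys) = begin
      countᵇ p (extensions y ++ concatMap extensions ys)
        ≡⟨ countᵇ-++ p (extensions y) (concatMap extensions ys) ⟩
      countᵇ p (extensions y) + countᵇ p (concatMap extensions ys)
        ≡⟨ cong₂ _+_ (withHead y) (byHead ys) ⟩
      countᵇ (λ y → does (y ≟ₐ a)) (y ∷ ys) ∎

  count-∈? : ∀ {xs} → IsEnumeration _≟ₐ_ xs → ∀ {ys} → Unique ys →
             countᵇ (λ x → does (x ∈? ys)) xs ≡ length ys
  count-∈? {xs} enum {[]}     []               = countᵇ-false (λ _ → refl) xs
  count-∈? {xs} enum {y ∷ ys} (y∉ys ∷ unique) = begin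
    countᵇ (λ x → does (x ≟ₐ y) ∨ does (x ∈? ys)) xs
      ≡⟨ countᵇ-∨ _ _ disjoint xs ⟩
    countᵇ (λ x → does (x ≟ₐ y)) xs + countᵇ (λ x → does (x ∈? ys)) xs
      ≡⟨ cong₂ _+_ (enum y) (count-∈? {xs} enum unique) ⟩
    ℕ.suc (length ys) ∎
    where
    disjoint : ∀ x → does (x ≟ₐ y) ≡ true → does (x ∈? ys) ≡ false
    disjoint x x≟y with x ≟ₐ y
    ... | yes refl = dec-false (x ∈? ys) (All.All¬⇒¬Any y∉ys)

<⇒<F : ∀ {n} {i j : Fin n} → i < j → (i <F j) ≡ true
<⇒<F i<j = Equivalence.to T-≡ (<⇒<ᵇ i<j)

<F⇒< : ∀ {n} {i j : Fin n} → (i <F j) ≡ true → i < j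
<F⇒< {i = i} {j} i<Fj = <ᵇ⇒< (toℕ i) (toℕ j) (Equivalence.from T-≡ i<Fj)

≮⇒<F-false : ∀ {n} {i j : Fin n} → ¬ i < j → (i <F j) ≡ false
≮⇒<F-false i≮j = ¬-not (i≮j ∘ <F⇒<)

covering⇒≤length : ∀ {n} {xs : List (Fin n)} → (∀ d → d ∈ xs) → n ℕ.≤ length xs
covering⇒≤length {xs = xs} member = injective⇒≤ λ {d} {e} same →
  trans (lookup-index (member d)) (trans (cong (List.lookup xs) same) (sym (lookup-index (member e))))

fresh : ∀ {n} (xs : List (Fin n)) → length xs ℕ.< n → ∃ λ d → d ∉ xs
fresh {n} xs |xs|<n = decidable-stable (any? λ d → ¬? (d ∈? xs)) λ ∄fresh →
  <⇒≱ |xs|<n (covering⇒≤length λ d → decidable-stable (d ∈? xs) λ d∉xs → ∄fresh (d , d∉xs))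
  where open DecMembership (_≟_ {n}) using (_∈?_)

twoOutside : ∀ {n} → 4 ≤ n → (v w : Fin n) →
  ∃ λ x → ∃ λ y → x ≢ v × x ≢ w × y ≢ v × y ≢ w × y ≢ x
twoOutside 4≤n v w with fresh (v ∷ w ∷ []) (<⇒≤ 4≤n)
... | x , x∉ with fresh (v ∷ w ∷ x ∷ []) 4≤n
... | y , y∉ =
  x , y , x∉ ∘ here , x∉ ∘ there ∘ here , y∉ ∘ here , y∉ ∘ there ∘ here , y∉ ∘ there ∘ there ∘ here

module _ {n : ℕ} where
  wlog-increasing₃ : (P : Fin n → Fin n → Fin n → Set) →
    (∀ {x y z} → P x y z → P y x z) → (∀ {x y z} → P x y z → P x z y) →
    (∀ {x y z} → x < y → y < z → P x y z) →
    ∀ {x y z} → x ≢ y → y ≢ z → x ≢ z → P x y z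
  wlog-increasing₃ P swap₁₂ swap₂₃ increasing {x} {y} {z} x≢y y≢z x≢z
    with <-cmp x y | <-cmp y z | <-cmp x z
  ... | tri≈ _ x≡y _ | _            | _            = contradiction x≡y x≢y
  ... | _            | tri≈ _ y≡z _ | _            = contradiction y≡z y≢z
  ... | _            | _            | tri≈ _ x≡z _ = contradiction x≡z x≢z
  ... | tri< x<y _ _ | tri< y<z _ _ | _            = increasing x<y y<z
  ... | tri< x<y _ _ | tri> _ _ z<y | tri< x<z _ _ = swap₂₃ (increasing x<z z<y)
  ... | tri< x<y _ _ | tri> _ _ z<y | tri> _ _ z<x = swap₂₃ (swap₁₂ (increasing z<x x<y))
  ... | tri> _ _ y<x | _            | tri< x<z _ _ = swap₁₂ (increasing y<x x<z)
  ... | tri> _ _ y<x | tri< y<z _ _ | tri> _ _ z<x = swap₁₂ (swap₂₃ (increasing y<z z<x))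
  ... | tri> _ _ y<x | tri> _ _ z<y | tri> _ _ _   = swap₁₂ (swap₂₃ (swap₁₂ (increasing z<y y<x)))

  wlog-increasing₄ : (P : Fin n → Fin n → Fin n → Fin n → Set) →
    (∀ {x y z w} → P x y z w → P y x z w) → (∀ {x y z w} → P x y z w → P x z y w) →
    (∀ {x y z w} → P x y z w → P x y w z) →
    (∀ {x y z w} → x < y → y < z → z < w → P x y z w) →
    ∀ {x y z w} → x ≢ y → x ≢ z → x ≢ w → y ≢ z → y ≢ w → z ≢ w → P x y z w
  wlog-increasing₄ P swap₁₂ swap₂₃ swap₃₄ increasing = anyOrder
    where
    insertFirst : ∀ {x y z w} → x ≢ y → x ≢ z → x ≢ w → y < z → z < w → P x y z w
    insertFirst {x} {y} {z} {w} x≢y x≢z x≢w y<z z<w with <-cmp x y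
    ... | tri< x<y _ _ = increasing x<y y<z z<w
    ... | tri≈ _ x≡y _ = contradiction x≡y x≢y
    ... | tri> _ _ y<x with <-cmp x z
    ...   | tri< x<z _ _ = swap₁₂ (increasing y<x x<z z<w)
    ...   | tri≈ _ x≡z _ = contradiction x≡z x≢z
    ...   | tri> _ _ z<x with <-cmp x w
    ...     | tri< x<w _ _ = swap₁₂ (swap₂₃ (increasing y<z z<x x<w))
    ...     | tri≈ _ x≡w _ = contradiction x≡w x≢w
    ...     | tri> _ _ w<x = swap₁₂ (swap₂₃ (swap₃₄ (increasing y<z z<w w<x)))

    insertSecond : ∀ {x y z w} → x ≢ y → x ≢ z → x ≢ w → y ≢ z → y ≢ w → z < w → P x y z w
    insertSecond {x} {y} {z} {w} x≢y x≢z x≢w y≢z y≢w z<w with <-cmp y z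
    ... | tri< y<z _ _ = insertFirst x≢y x≢z x≢w y<z z<w
    ... | tri≈ _ y≡z _ = contradiction y≡z y≢z
    ... | tri> _ _ z<y with <-cmp y w
    ...   | tri< y<w _ _ = swap₂₃ (insertFirst x≢z x≢y x≢w z<y y<w)
    ...   | tri≈ _ y≡w _ = contradiction y≡w y≢w
    ...   | tri> _ _ w<y = swap₂₃ (swap₃₄ (insertFirst x≢z x≢w x≢y z<w w<y))

    anyOrder : ∀ {x y z w} → x ≢ y → x ≢ z → x ≢ w → y ≢ z → y ≢ w → z ≢ w → P x y z w
    anyOrder {x} {y} {z} {w} x≢y x≢z x≢w y≢z y≢w z≢w with <-cmp z w
    ... | tri< z<w _ _ = insertSecond x≢y x≢z x≢w y≢z y≢w z<w
    ... | tri≈ _ z≡w _ = contradiction z≡w z≢w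
    ... | tri> _ _ w<z = swap₃₄ (insertSecond x≢y x≢w x≢z y≢w y≢z w<z)

complete : ∀ {n} → Fin n → Fin n → Fin n → Bool
complete _ _ _ = true

avoiding : ∀ {n} → Fin n → Fin n → Fin n → Fin n → Bool
avoiding v x y z = not (does (x ≟ v) ∨ does (y ≟ v) ∨ does (z ≟ v))

avoiding-apex : ∀ {n} (v y z : Fin n) → avoiding v v y z ≡ false
avoiding-apex v y z rewrite dec-true (v ≟ v) refl = refl

avoiding-off : ∀ {n} {v x y z : Fin n} → x ≢ v → y ≢ v → z ≢ v → avoiding v x y z ≡ true
avoiding-off {v = v} {x} {y} {z} x≢v y≢v z≢v
  rewrite dec-false (x ≟ v) x≢v | dec-false (y ≟ v) y≢v | dec-false (z ≟ v) z≢v = refl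

avoiding-swap₁₂ : ∀ {n} (v x y z : Fin n) → avoiding v x y z ≡ avoiding v y x z
avoiding-swap₁₂ v x y z = cong not (begin
  a ∨ b ∨ c   ≡⟨ ∨-assoc a b c ⟨
  (a ∨ b) ∨ c ≡⟨ cong (_∨ c) (∨-comm a b) ⟩
  (b ∨ a) ∨ c ≡⟨ ∨-assoc b a c ⟩
  b ∨ a ∨ c   ∎)
  where
  a = does (x ≟ v)
  b = does (y ≟ v)
  c = does (z ≟ v)

avoiding-swap₂₃ : ∀ {n} (v x y z : Fin n) → avoiding v x y z ≡ avoiding v x z y
avoiding-swap₂₃ v x y z = cong (λ b → not (does (x ≟ v) ∨ b)) (∨-comm (does (y ≟ v)) (does (z ≟ v)))

avoiding-oneOrAll : ∀ {n} (v : Fin n) {a b c d} → a < b → b < c → c < d →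
  OneOrAll (avoiding v a b c) (avoiding v a b d) (avoiding v a c d) (avoiding v b c d)
avoiding-oneOrAll v {a} {b} {c} {d} a<b b<c c<d with a ≟ v | b ≟ v | c ≟ v | d ≟ v
... | no _     | no _     | no _     | no _     = all₄
... | yes refl | no _     | no _     | no _     = only₄
... | no _     | yes refl | no _     | no _     = only₃
... | no _     | no _     | yes refl | no _     = only₂
... | no _     | no _     | no _     | yes refl = only₁
... | yes refl | yes refl | _        | _        = contradiction refl (<⇒≢ a<b)
... | yes refl | no _     | yes refl | _        = contradiction refl (<⇒≢ (<-trans a<b b<c))
... | yes refl | no _     | no _     | yes refl = contradiction refl (<⇒≢ (<-trans a<b (<-trans b<c c<d)))
... | no _     | yes refl | yes refl | _        = contradiction refl (<⇒≢ b<c)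
... | no _     | yes refl | no _     | yes refl = contradiction refl (<⇒≢ (<-trans b<c c<d))
... | no _     | no _     | yes refl | yes refl = contradiction refl (<⇒≢ c<d)

module TripleSystem {n : ℕ} (E : Fin n → Fin n → Fin n → Bool)
  (E-swap₁₂ : ∀ x y z → E x y z ≡ E y x z)
  (E-swap₂₃ : ∀ x y z → E x y z ≡ E x z y)
  (E-oneOrAll : ∀ {x y z w} → x ≢ y → x ≢ z → x ≢ w → y ≢ z → y ≢ w → z ≢ w →
                OneOrAll (E x y z) (E x y w) (E x z w) (E y z w))
  where

  record OnlyEdge (v p q s : Fin n) : Set where
    field
      ¬vpq : E v p q ≡ false
      ¬vps : E v p s ≡ false
      ¬vqs : E v q s ≡ false
      pqs  : E p q s ≡ true
      v≢p  : v ≢ p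
      v≢q  : v ≢ q
      v≢s  : v ≢ s
      p≢q  : p ≢ q
      p≢s  : p ≢ s
      q≢s  : q ≢ s

  private variable a b c d v p q s u x y z : Fin n

  onlyEdge-swap₁₂ : OnlyEdge v p q s → OnlyEdge v q p s
  onlyEdge-swap₁₂ {v} {p} {q} {s} o = record
    { ¬vpq = trans (E-swap₂₃ v q p) ¬vpq ; ¬vps = ¬vqs ; ¬vqs = ¬vps ; pqs = trans (E-swap₁₂ q p s) pqs
    ; v≢p = v≢q ; v≢q = v≢p ; v≢s = v≢s ; p≢q = ≢-sym p≢q ; p≢s = q≢s ; q≢s = p≢s }
    where open OnlyEdge o

  onlyEdge-swap₂₃ : OnlyEdge v p q s → OnlyEdge v p s q
  onlyEdge-swap₂₃ {v} {p} {q} {s} o = record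
    { ¬vpq = ¬vps ; ¬vps = ¬vpq ; ¬vqs = trans (E-swap₂₃ v s q) ¬vqs ; pqs = trans (E-swap₂₃ p s q) pqs
    ; v≢p = v≢p ; v≢q = v≢s ; v≢s = v≢q ; p≢q = p≢s ; p≢s = p≢q ; q≢s = ≢-sym q≢s }
    where open OnlyEdge o

  extend : OnlyEdge v p q s → u ≢ v → u ≢ p → u ≢ q → u ≢ s → OnlyEdge v p q u
  extend o u≢v u≢p u≢q u≢s = record
    { ¬vpq = ¬vpq ; ¬vps = proj₁ forced ; ¬vqs = proj₁ (proj₂ forced) ; pqs = proj₂ (proj₂ forced)
    ; v≢p = v≢p ; v≢q = v≢q ; v≢s = ≢-sym u≢v ; p≢q = p≢q ; p≢s = ≢-sym u≢p ; q≢s = ≢-sym u≢q }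
    where
    open OnlyEdge o
    forced = oneOrAll-extend
      (oneOrAll-cong ¬vpq refl refl refl (E-oneOrAll v≢p v≢q (≢-sym u≢v) p≢q (≢-sym u≢p) (≢-sym u≢q)))
      (oneOrAll-cong ¬vps refl refl refl (E-oneOrAll v≢p v≢s (≢-sym u≢v) p≢s (≢-sym u≢p) (≢-sym u≢s)))
      (oneOrAll-cong ¬vqs refl refl refl (E-oneOrAll v≢q v≢s (≢-sym u≢v) q≢s (≢-sym u≢q) (≢-sym u≢s)))
      (oneOrAll-cong pqs  refl refl refl (E-oneOrAll p≢q p≢s (≢-sym u≢p) q≢s (≢-sym u≢q) (≢-sym u≢s)))

  replace : OnlyEdge v p q s → u ≢ v → u ≢ p → u ≢ q → OnlyEdge v p q u
  replace {s = s} {u = u} o u≢v u≢p u≢q with u ≟ s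
  ... | yes refl = o
  ... | no u≢s   = extend o u≢v u≢p u≢q u≢s

  through : OnlyEdge v p q s → y ≢ v → ∃ λ α → ∃ λ β → OnlyEdge v y α β
  through {p = p} {q} {s} {y} o y≢v with y ≟ p | y ≟ q
  ... | yes refl | _        = q , s , o
  ... | no _     | yes refl = p , s , onlyEdge-swap₁₂ o
  ... | no y≢p   | no y≢q   = p , q , onlyEdge-swap₁₂ (onlyEdge-swap₂₃ (replace o y≢v y≢p y≢q))

  apex-nonEdge : OnlyEdge v p q s → y ≢ v → z ≢ v → y ≢ z → E v y z ≡ false
  apex-nonEdge {z = z} o y≢v z≢v y≢z with through o y≢v
  ... | α , β , o′ with z ≟ α
  ...   | yes refl = OnlyEdge.¬vpq o′
  ...   | no z≢α   = OnlyEdge.¬vps (replace o′ z≢v (≢-sym y≢z) z≢α)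

  offApex-edge : OnlyEdge v p q s → x ≢ v → y ≢ v → z ≢ v → x ≢ y → x ≢ z → y ≢ z → E x y z ≡ true
  offApex-edge o x≢v y≢v z≢v x≢y x≢z y≢z = oneOrAll-last
    (oneOrAll-cong (apex-nonEdge o x≢v y≢v x≢y) (apex-nonEdge o x≢v z≢v x≢z) (apex-nonEdge o y≢v z≢v y≢z) refl
      (E-oneOrAll (≢-sym x≢v) (≢-sym y≢v) (≢-sym z≢v) x≢y x≢z y≢z))

  onlyEdge⇒avoiding : OnlyEdge v p q s → x ≢ y → x ≢ z → y ≢ z → E x y z ≡ avoiding v x y z
  onlyEdge⇒avoiding {v} {x = x} {y} {z} o x≢y x≢z y≢z with x ≟ v
  ... | yes refl = apex-nonEdge o (≢-sym x≢y) (≢-sym x≢z) y≢z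
  ... | no x≢v with y ≟ v
  ...   | yes refl = trans (E-swap₁₂ x y z) (apex-nonEdge o x≢v (≢-sym y≢z) x≢z)
  ...   | no y≢v with z ≟ v
  ...     | yes refl = trans (E-swap₂₃ x y z) (trans (E-swap₁₂ x z y) (apex-nonEdge o x≢v y≢v x≢y))
  ...     | no z≢v   = offApex-edge o x≢v y≢v z≢v x≢y x≢z y≢z

  nonEdge⇒onlyEdge : E a b c ≡ false → a ≢ b → a ≢ c → b ≢ c → d ≢ a → d ≢ b → d ≢ c →
    ∃ λ v → ∃ λ p → ∃ λ q → ∃ λ s → OnlyEdge v p q s
  nonEdge⇒onlyEdge {a} {b} {c} {d} ¬abc a≢b a≢c b≢c d≢a d≢b d≢c = pick refl refl refl
    (oneOrAll-cong ¬abc refl refl refl (E-oneOrAll a≢b a≢c (≢-sym d≢a) b≢c (≢-sym d≢b) (≢-sym d≢c)))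
    where
    pick : ∀ {α β γ} → E a b d ≡ α → E a c d ≡ β → E b c d ≡ γ → OneOrAll false α β γ →
           ∃ λ v → ∃ λ p → ∃ λ q → ∃ λ s → OnlyEdge v p q s
    pick abd acd bcd only₄ = a , b , c , d , record
      { ¬vpq = ¬abc ; ¬vps = abd ; ¬vqs = acd ; pqs = bcd
      ; v≢p = a≢b ; v≢q = a≢c ; v≢s = ≢-sym d≢a ; p≢q = b≢c ; p≢s = ≢-sym d≢b ; q≢s = ≢-sym d≢c }
    pick abd acd bcd only₃ = b , a , c , d , record
      { ¬vpq = trans (E-swap₁₂ b a c) ¬abc ; ¬vps = trans (E-swap₁₂ b a d) abd ; ¬vqs = bcd ; pqs = acd
      ; v≢p = ≢-sym a≢b ; v≢q = b≢c ; v≢s = ≢-sym d≢b ; p≢q = a≢c ; p≢s = ≢-sym d≢a ; q≢s = ≢-sym d≢c }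
    pick abd acd bcd only₂ = c , a , b , d , record
      { ¬vpq = trans (E-swap₁₂ c a b) (trans (E-swap₂₃ a c b) ¬abc) ; ¬vps = trans (E-swap₁₂ c a d) acd
      ; ¬vqs = trans (E-swap₁₂ c b d) bcd ; pqs = abd
      ; v≢p = ≢-sym a≢c ; v≢q = ≢-sym b≢c ; v≢s = ≢-sym d≢c ; p≢q = a≢b ; p≢s = ≢-sym d≢a ; q≢s = ≢-sym d≢b }

wellFormed⇒increasing : ∀ {n} {H : Cube n} → WellFormed H ≡ true →
  ∀ {i j k} → entry H i j k ≡ true → i < j × j < k
wellFormed⇒increasing wf {i} {j} {k} ijk = <F⇒< (∧-conicalˡ _ _ sorted) , <F⇒< (∧-conicalʳ _ _ sorted)
  where sorted = not∨-elim (∀v-elim (∀v-elim (∀v-elim wf i) j) k) ijk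

nonIncreasing⇒nonEdge : ∀ {n} {H : Cube n} → WellFormed H ≡ true →
  ∀ {i j k} → (i < j → j < k → ⊥) → entry H i j k ≡ false
nonIncreasing⇒nonEdge {H = H} wf {i} {j} {k} notIncreasing =
  ¬-not λ ijk → let (i<j , j<k) = wellFormed⇒increasing {H = H} wf ijk in notIncreasing i<j j<k

avoids⇒oneOrAll : ∀ {n} {H : Cube n} → Avoids L₀₂₃ H ≡ true → ∀ {a b c d} → a < b → b < c → c < d →
  OneOrAll (entry H a b c) (entry H a b d) (entry H a c d) (entry H b c d)
avoids⇒oneOrAll av {a} {b} {c} {d} a<b b<c c<d =
  ∉L₀₂₃⇒oneOrAll _ _ _ _ (not∨-elim (∀v-elim (∀v-elim (∀v-elim (∀v-elim av a) b) c) d) increasing)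
  where
  increasing : ((a <F b) ∧ (b <F c) ∧ (c <F d)) ≡ true
  increasing rewrite <⇒<F a<b | <⇒<F b<c | <⇒<F c<d = refl

cubeOf : ∀ {n} → (Fin n → Fin n → Fin n → Bool) → Cube n
cubeOf r = tabulateᵥ λ i → tabulateᵥ λ j → tabulateᵥ λ k → (i <F j) ∧ (j <F k) ∧ r i j k

entry-cubeOf : ∀ {n} (r : Fin n → Fin n → Fin n → Bool) i j k →
  entry (cubeOf r) i j k ≡ ((i <F j) ∧ (j <F k) ∧ r i j k)
entry-cubeOf r i j k
  rewrite lookup∘tabulate (λ i → tabulateᵥ λ j → tabulateᵥ λ k → (i <F j) ∧ (j <F k) ∧ r i j k) i
        | lookup∘tabulate (λ j → tabulateᵥ λ k → (i <F j) ∧ (j <F k) ∧ r i j k) j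
        = lookup∘tabulate (λ k → (i <F j) ∧ (j <F k) ∧ r i j k) k

entry-cubeOf-increasing : ∀ {n} (r : Fin n → Fin n → Fin n → Bool) {i j k} → i < j → j < k →
  entry (cubeOf r) i j k ≡ r i j k
entry-cubeOf-increasing r {i} {j} {k} i<j j<k
  rewrite entry-cubeOf r i j k | <⇒<F i<j | <⇒<F j<k = refl

cubeOf-wellFormed : ∀ {n} (r : Fin n → Fin n → Fin n → Bool) → WellFormed (cubeOf r) ≡ true
cubeOf-wellFormed r = ∀v-intro λ i → ∀v-intro λ j → ∀v-intro λ k →
  not∨-intro λ ijk → dropLast (i <F j) (j <F k) (r i j k) (trans (sym (entry-cubeOf r i j k)) ijk)
  where
  dropLast : ∀ a b c → (a ∧ b ∧ c) ≡ true → (a ∧ b) ≡ true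
  dropLast true true true _ = refl

cubeOf-avoids : ∀ {n} {r : Fin n → Fin n → Fin n → Bool} →
  (∀ {a b c d} → a < b → b < c → c < d → OneOrAll (r a b c) (r a b d) (r a c d) (r b c d)) →
  Avoids L₀₂₃ (cubeOf r) ≡ true
cubeOf-avoids {r = r} allowed =
  ∀v-intro λ a → ∀v-intro λ b → ∀v-intro λ c → ∀v-intro λ d → not∨-intro λ increasing →
    let a<b = <F⇒< {i = a} {b} (∧-conicalˡ (a <F b) _ increasing)
        b<c = <F⇒< {i = b} {c} (∧-conicalˡ (b <F c) _ (∧-conicalʳ (a <F b) _ increasing))
        c<d = <F⇒< {i = c} {d} (∧-conicalʳ (b <F c) _ (∧-conicalʳ (a <F b) _ increasing))
    in oneOrAll⇒∉L₀₂₃ (oneOrAll-cong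
         (sym (entry-cubeOf-increasing r {a} {b} {c} a<b b<c))
         (sym (entry-cubeOf-increasing r {a} {b} {d} a<b (<-trans b<c c<d)))
         (sym (entry-cubeOf-increasing r {a} {c} {d} (<-trans a<b b<c) c<d))
         (sym (entry-cubeOf-increasing r {b} {c} {d} b<c c<d))
         (allowed {a} {b} {c} {d} a<b b<c c<d))

cube-ext : ∀ {n} {H H′ : Cube n} → (∀ i j k → entry H i j k ≡ entry H′ i j k) → H ≡ H′
cube-ext {H = H} {H′} same = begin
  H         ≡⟨ tabulate-entries H ⟨
  tabulateᵥ (λ i → tabulateᵥ λ j → tabulateᵥ λ k → entry H i j k)
    ≡⟨ tabulate-cong (λ i → tabulate-cong λ j → tabulate-cong (same i j)) ⟩
  tabulateᵥ (λ i → tabulateᵥ λ j → tabulateᵥ λ k → entry H′ i j k)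
    ≡⟨ tabulate-entries H′ ⟩
  H′        ∎
  where
  tabulate-entries : ∀ G → tabulateᵥ (λ i → tabulateᵥ λ j → tabulateᵥ λ k → entry G i j k) ≡ G
  tabulate-entries G = trans
    (tabulate-cong λ i → trans (tabulate-cong λ j → tabulate∘lookup (lookup (lookup G i) j))
                               (tabulate∘lookup (lookup G i)))
    (tabulate∘lookup G)

wellFormed⇒≡cubeOf : ∀ {n} {H : Cube n} {r : Fin n → Fin n → Fin n → Bool} → WellFormed H ≡ true →
  (∀ {i j k} → i < j → j < k → entry H i j k ≡ r i j k) → H ≡ cubeOf r
wellFormed⇒≡cubeOf {H = H} {r} wf agree =
  cube-ext λ i j k → trans (entries i j k) (sym (entry-cubeOf r i j k))
  where
  entries : ∀ i j k → entry H i j k ≡ ((i <F j) ∧ (j <F k) ∧ r i j k)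
  entries i j k with i <? j | j <? k
  ... | yes i<j | yes j<k rewrite <⇒<F i<j | <⇒<F j<k = agree i<j j<k
  ... | yes i<j | no j≮k  rewrite <⇒<F i<j | ≮⇒<F-false j≮k =
    nonIncreasing⇒nonEdge {H = H} wf {i} {j} {k} λ _ → j≮k
  ... | no i≮j  | _       rewrite ≮⇒<F-false i≮j =
    nonIncreasing⇒nonEdge {H = H} wf {i} {j} {k} λ i<j _ → i≮j i<j

edge : ∀ {n} → Cube n → Fin n → Fin n → Fin n → Bool
edge H x y z = entry H x y z ∨ entry H x z y ∨ entry H y x z ∨ entry H y z x ∨ entry H z x y ∨ entry H z y x

edge-swap₁₂ : ∀ {n} (H : Cube n) x y z → edge H x y z ≡ edge H y x z
edge-swap₁₂ H x y z = solve 6 (λ a b c d e f → a ⊕ b ⊕ c ⊕ d ⊕ e ⊕ f ⊜ c ⊕ d ⊕ a ⊕ b ⊕ f ⊕ e) refl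
  (entry H x y z) (entry H x z y) (entry H y x z) (entry H y z x) (entry H z x y) (entry H z y x)

edge-swap₂₃ : ∀ {n} (H : Cube n) x y z → edge H x y z ≡ edge H x z y
edge-swap₂₃ H x y z = solve 6 (λ a b c d e f → a ⊕ b ⊕ c ⊕ d ⊕ e ⊕ f ⊜ b ⊕ a ⊕ e ⊕ f ⊕ c ⊕ d) refl
  (entry H x y z) (entry H x z y) (entry H y x z) (entry H y z x) (entry H z x y) (entry H z y x)

edge-increasing : ∀ {n} {H : Cube n} → WellFormed H ≡ true → ∀ {x y z} → x < y → y < z →
  edge H x y z ≡ entry H x y z
edge-increasing {H = H} wf {x} {y} {z} x<y y<z
  rewrite nonIncreasing⇒nonEdge {H = H} wf {x} {z} {y} (λ _ z<y → <-asym y<z z<y)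
        | nonIncreasing⇒nonEdge {H = H} wf {y} {x} {z} (λ y<x _ → <-asym x<y y<x)
        | nonIncreasing⇒nonEdge {H = H} wf {y} {z} {x} (λ _ z<x → <-asym (<-trans x<y y<z) z<x)
        | nonIncreasing⇒nonEdge {H = H} wf {z} {x} {y} (λ z<x _ → <-asym (<-trans x<y y<z) z<x)
        | nonIncreasing⇒nonEdge {H = H} wf {z} {y} {x} (λ z<y _ → <-asym y<z z<y)
        = ∨-identityʳ (entry H x y z)

edge-oneOrAll : ∀ {n} {H : Cube n} → WellFormed H ≡ true → Avoids L₀₂₃ H ≡ true →
  ∀ {x y z w} → x ≢ y → x ≢ z → x ≢ w → y ≢ z → y ≢ w → z ≢ w →
  OneOrAll (edge H x y z) (edge H x y w) (edge H x z w) (edge H y z w)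
edge-oneOrAll {n} {H} wf av = wlog-increasing₄ P swap₁₂ swap₂₃ swap₃₄ increasing
  where
  P : Fin n → Fin n → Fin n → Fin n → Set
  P x y z w = OneOrAll (edge H x y z) (edge H x y w) (edge H x z w) (edge H y z w)

  swap₁₂ : ∀ {x y z w} → P x y z w → P y x z w
  swap₁₂ {x} {y} {z} {w} =
    oneOrAll-cong (edge-swap₁₂ H x y z) (edge-swap₁₂ H x y w) refl refl ∘ oneOrAll-swap₃₄
  swap₂₃ : ∀ {x y z w} → P x y z w → P x z y w
  swap₂₃ {x} {y} {z} {w} =
    oneOrAll-cong (edge-swap₂₃ H x y z) refl refl (edge-swap₁₂ H y z w) ∘ oneOrAll-swap₂₃
  swap₃₄ : ∀ {x y z w} → P x y z w → P x y w z
  swap₃₄ {x} {y} {z} {w} =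
    oneOrAll-cong refl refl (edge-swap₂₃ H x z w) (edge-swap₂₃ H y z w) ∘ oneOrAll-swap₁₂
  increasing : ∀ {x y z w} → x < y → y < z → z < w → P x y z w
  increasing {x} {y} {z} {w} x<y y<z z<w = oneOrAll-cong
    (sym (edge-increasing {H = H} wf {x} {y} {z} x<y y<z))
    (sym (edge-increasing {H = H} wf {x} {y} {w} x<y (<-trans y<z z<w)))
    (sym (edge-increasing {H = H} wf {x} {z} {w} (<-trans x<y y<z) z<w))
    (sym (edge-increasing {H = H} wf {y} {z} {w} y<z z<w))
    (avoids⇒oneOrAll {H = H} av x<y y<z z<w)

edge-cubeOf : ∀ {n} {r : Fin n → Fin n → Fin n → Bool} →
  (∀ x y z → r x y z ≡ r y x z) → (∀ x y z → r x y z ≡ r x z y) →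
  ∀ {x y z} → x ≢ y → y ≢ z → x ≢ z → edge (cubeOf r) x y z ≡ r x y z
edge-cubeOf {n} {r} r-swap₁₂ r-swap₂₃ = wlog-increasing₃ P swap₁₂ swap₂₃ increasing
  where
  P : Fin n → Fin n → Fin n → Set
  P x y z = edge (cubeOf r) x y z ≡ r x y z
  swap₁₂ : ∀ {x y z} → P x y z → P y x z
  swap₁₂ {x} {y} {z} h = trans (sym (edge-swap₁₂ (cubeOf r) x y z)) (trans h (r-swap₁₂ x y z))
  swap₂₃ : ∀ {x y z} → P x y z → P x z y
  swap₂₃ {x} {y} {z} h = trans (sym (edge-swap₂₃ (cubeOf r) x y z)) (trans h (r-swap₂₃ x y z))
  increasing : ∀ {x y z} → x < y → y < z → P x y z
  increasing {x} {y} {z} x<y y<z =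
    trans (edge-increasing {H = cubeOf r} (cubeOf-wellFormed r) {x} {y} {z} x<y y<z)
          (entry-cubeOf-increasing r {x} {y} {z} x<y y<z)

module CubeSystem {n} {H : Cube n} (wf : WellFormed H ≡ true) (av : Avoids L₀₂₃ H ≡ true) =
  TripleSystem (edge H) (edge-swap₁₂ H) (edge-swap₂₃ H) (edge-oneOrAll {H = H} wf av)

nonEdge⇒avoiding : ∀ {n} {H : Cube n} → 4 ≤ n → WellFormed H ≡ true → Avoids L₀₂₃ H ≡ true →
  ∀ {a b c} → a < b → b < c → entry H a b c ≡ false → ∃ λ v → H ≡ cubeOf (avoiding v)
nonEdge⇒avoiding {H = H} 4≤n wf av {a} {b} {c} a<b b<c ¬abc =
  let d , d∉ = fresh (a ∷ b ∷ c ∷ []) 4≤n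
      v , _ , _ , _ , onlyEdge = nonEdge⇒onlyEdge (trans (edge-increasing {H = H} wf a<b b<c) ¬abc)
        (<⇒≢ a<b) (<⇒≢ (<-trans a<b b<c)) (<⇒≢ b<c)
        (d∉ ∘ here) (d∉ ∘ there ∘ here) (d∉ ∘ there ∘ there ∘ here)
  in v , wellFormed⇒≡cubeOf {H = H} wf λ {x} {y} {z} x<y y<z →
         trans (sym (edge-increasing {H = H} wf x<y y<z))
               (onlyEdge⇒avoiding onlyEdge (<⇒≢ x<y) (<⇒≢ (<-trans x<y y<z)) (<⇒≢ y<z))
  where open CubeSystem {H = H} wf av

classify : ∀ {n} {H : Cube n} → 4 ≤ n → WellFormed H ≡ true → Avoids L₀₂₃ H ≡ true →
  H ≡ cubeOf complete ⊎ ∃ λ v → H ≡ cubeOf (avoiding v)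
classify {n} {H} 4≤n wf av
  with any? (λ i → any? λ j → any? λ k → i <? j ×-dec j <? k ×-dec entry H i j k ≟ᵇ false)
... | no ∄nonEdge = inj₁ (wellFormed⇒≡cubeOf {H = H} wf λ {i} {j} {k} i<j j<k →
        ¬-not λ ¬ijk → ∄nonEdge (i , j , k , i<j , j<k , ¬ijk))
... | yes (a , b , c , a<b , b<c , ¬abc) = inj₂ (nonEdge⇒avoiding 4≤n wf av a<b b<c ¬abc)

edge-complete : ∀ {n} {x y z : Fin n} → x ≢ y → y ≢ z → x ≢ z → edge (cubeOf complete) x y z ≡ true
edge-complete = edge-cubeOf (λ _ _ _ → refl) (λ _ _ _ → refl)

edge-avoiding : ∀ {n} (v : Fin n) {x y z} → x ≢ y → y ≢ z → x ≢ z →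
  edge (cubeOf (avoiding v)) x y z ≡ avoiding v x y z
edge-avoiding v = edge-cubeOf (avoiding-swap₁₂ v) (avoiding-swap₂₃ v)

complete≢avoiding : ∀ {n} → 4 ≤ n → (v : Fin n) → cubeOf complete ≢ cubeOf (avoiding v)
complete≢avoiding 4≤n v same =
  let x , y , x≢v , _ , y≢v , _ , y≢x = twoOutside 4≤n v v in contradiction (begin
  true                                ≡⟨ edge-complete (≢-sym x≢v) (≢-sym y≢x) (≢-sym y≢v) ⟨
  edge (cubeOf complete) v x y        ≡⟨ cong (λ H → edge H v x y) same ⟩
  edge (cubeOf (avoiding v)) v x y    ≡⟨ edge-avoiding v (≢-sym x≢v) (≢-sym y≢x) (≢-sym y≢v) ⟩
  avoiding v v x y                    ≡⟨ avoiding-apex v x y ⟩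
  false                               ∎) λ ()

avoiding-injective : ∀ {n} → 4 ≤ n → {v w : Fin n} → v ≢ w → cubeOf (avoiding v) ≢ cubeOf (avoiding w)
avoiding-injective 4≤n {v} {w} v≢w same =
  let x , y , x≢v , x≢w , y≢v , y≢w , y≢x = twoOutside 4≤n v w in contradiction (begin
  false                               ≡⟨ avoiding-apex v x y ⟨
  avoiding v v x y                    ≡⟨ edge-avoiding v (≢-sym x≢v) (≢-sym y≢x) (≢-sym y≢v) ⟨
  edge (cubeOf (avoiding v)) v x y    ≡⟨ cong (λ H → edge H v x y) same ⟩
  edge (cubeOf (avoiding w)) v x y    ≡⟨ edge-avoiding w (≢-sym x≢v) (≢-sym y≢x) (≢-sym y≢v) ⟩
  avoiding w v x y                    ≡⟨ avoiding-off v≢w x≢w y≢w ⟩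
  true                                ∎) λ ()

candidates : (n : ℕ) → List (Cube n)
candidates n = cubeOf complete ∷ tabulate (cubeOf ∘ avoiding)

candidates-unique : ∀ {n} → 4 ≤ n → Unique (candidates n)
candidates-unique 4≤n = All.tabulate⁺ (complete≢avoiding 4≤n) ∷ AllPairs.tabulate⁺ (avoiding-injective 4≤n)

_≟ᶜ_ : ∀ {n} → DecidableEquality (Cube n)
_≟ᶜ_ = ≡-dec (≡-dec (≡-dec _≟ᵇ_))

_∈ᶜ?_ : ∀ {n} (H : Cube n) (Hs : List (Cube n)) → Dec (H ∈ Hs)
_∈ᶜ?_ = DecMembership._∈?_ _≟ᶜ_

allCubes-enumeration : ∀ n → IsEnumeration _≟ᶜ_ (allCubes n)
allCubes-enumeration n =
  allVec-enumeration _ (allVec-enumeration _ (allVec-enumeration _≟ᵇ_ bools n) n) n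
  where
  bools : IsEnumeration _≟ᵇ_ (true ∷ false ∷ [])
  bools true  = refl
  bools false = refl

cubeOf-good : ∀ {n} {r : Fin n → Fin n → Fin n → Bool} →
  (∀ {a b c d} → a < b → b < c → c < d → OneOrAll (r a b c) (r a b d) (r a c d) (r b c d)) →
  (WellFormed (cubeOf r) ∧ Avoids L₀₂₃ (cubeOf r)) ≡ true
cubeOf-good {r = r} allowed = cong₂ _∧_ (cubeOf-wellFormed r) (cubeOf-avoids allowed)

candidate⇒good : ∀ {n} {H : Cube n} → H ∈ candidates n → (WellFormed H ∧ Avoids L₀₂₃ H) ≡ true
candidate⇒good {n} (here refl) = cubeOf-good {n} {complete} (λ _ _ _ → all₄)
candidate⇒good {n} (there H∈) with ∈-tabulate⁻ H∈
... | v , refl = cubeOf-good {n} {avoiding v} (avoiding-oneOrAll v)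

good⇒candidate : ∀ {n} {H : Cube n} → 4 ≤ n → (WellFormed H ∧ Avoids L₀₂₃ H) ≡ true → H ∈ candidates n
good⇒candidate {H = H} 4≤n good
  with classify {H = H} 4≤n (∧-conicalˡ (WellFormed H) _ good) (∧-conicalʳ (WellFormed H) _ good)
... | inj₁ refl       = here refl
... | inj₂ (v , refl) = there (∈-tabulate⁺ v)

good⇔candidate : ∀ {n} → 4 ≤ n → ∀ H → (WellFormed H ∧ Avoids L₀₂₃ H) ≡ does (H ∈ᶜ? candidates n)
good⇔candidate {n} 4≤n H = byDecision (H ∈ᶜ? candidates n)
  where
  byDecision : (H∈? : Dec (H ∈ candidates n)) → (WellFormed H ∧ Avoids L₀₂₃ H) ≡ does H∈?
  byDecision (yes H∈) = candidate⇒good H∈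
  byDecision (no H∉)  = ¬-not λ good → H∉ (good⇒candidate 4≤n good)

f34-L₀₂₃ : ∀ {n} → 4 ≤ n → f34 n L₀₂₃ ≡ ℕ.suc n
f34-L₀₂₃ {n} 4≤n = begin
  countᵇ (λ H → WellFormed H ∧ Avoids L₀₂₃ H) (allCubes n)
    ≡⟨ countᵇ-cong (good⇔candidate 4≤n) (allCubes n) ⟩
  countᵇ (λ H → does (H ∈ᶜ? candidates n)) (allCubes n)
    ≡⟨ count-∈? _≟ᶜ_ {allCubes n} (allCubes-enumeration n) (candidates-unique 4≤n) ⟩
  length (candidates n)
    ≡⟨ cong ℕ.suc (length-tabulate (cubeOf ∘ avoiding)) ⟩
  ℕ.suc n ∎

claim4p7 : (n : ℕ) → 5 ≤ n → f34 n (0 ∷ 2 ∷ 3 ∷ []) ≡ n + 1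
claim4p7 n 5≤n = trans (f34-L₀₂₃ (≤-trans (n≤1+n 4) 5≤n)) (+-comm 1 n)
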